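{- Let $m, n, k$ be positive integers with $n$ odd and $k$ even. Then there exists a positive integer $D$ such that the continued fraction expansion of $\sqrt{D}$ has the form $\sqrt{D} = [a_0; \overline{a_1, \ldots, a_k}]$ with period length $k$, and $D \equiv m \pmod n$.
   Context: For a positive non-square integer $D$, the continued fraction expansion of $\sqrt{D}$ has the form $[a_0; \overline{a_1, \ldots, a_k}]$ with positive integers $a_i$, $a_k = 2a_0$, $(a_1,\dots,a_{k-1})$ a palindrome; $k$ is the period length. -}

module Defs where

open import Data.Nat using (ℕ; zero; suc; _+_; _*_; _∸_; _≤_; _<_; _≤ᵇ_)
open import Data.Nat.DivMod using (_/_)
open import Data.Bool using (if_then_else_)
open import Data.Product using (_×_; _,_; proj₁; proj₂)
open import Relation.Binary.PropositionalEquality using (_≡_; _≢_)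
open import Relation.Nullary using (¬_)

isqrt : ℕ → ℕ
isqrt zero = zero
isqrt (suc n) with isqrt n
... | r = if (suc r * suc r) ≤ᵇ suc n then suc r else r

NonSquare : ℕ → Set
NonSquare D = ∀ r → r * r ≢ D

-- total division (x / 0 := 0; never used with a zero divisor for non-square D)
_div_ : ℕ → ℕ → ℕ
x div zero = zero
x div suc q = x / suc q

-- State (P_i , Q_i , a_i): the i-th complete quotient of √D is
-- x_i = (P_i + √D) / Q_i and a_i = ⌊x_i⌋ is the i-th partial quotient.
-- Standard exact-arithmetic continued fraction algorithm for √D:
--   P_0 = 0, Q_0 = 1, a_0 = ⌊√D⌋,
--   P_{i+1} = a_i Q_i - P_i,  Q_{i+1} = (D - P_{i+1}^2) / Q_i,
--   a_{i+1} = ⌊(a_0 + P_{i+1}) / Q_{i+1}⌋.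
cfState : ℕ → ℕ → ℕ × ℕ × ℕ
cfState D zero = 0 , 1 , isqrt D
cfState D (suc i) with cfState D i
... | P , Q , a =
  let P' = a * Q ∸ P
      Q' = (D ∸ P' * P') div Q
  in P' , Q' , ((isqrt D + P') div Q')

cfCoeff : ℕ → ℕ → ℕ
cfCoeff D i = proj₂ (proj₂ (cfState D i))

IsPeriod : ℕ → ℕ → Set
IsPeriod D j = ∀ i → 1 ≤ i → cfCoeff D (i + j) ≡ cfCoeff D i

PeriodLength : ℕ → ℕ → Set
PeriodLength D k =
  1 ≤ k × IsPeriod D k × (∀ j → 1 ≤ j → j < k → ¬ IsPeriod D j)

{-# OPTIONS --safe #-}
-- Let r = 1 + d t, a₀ = y + d with y + a₀ = c r^s t, and D = a₀² + c r^s. Then a₀² < D ≤ a₀² + 2a₀,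
-- so ⌊√D⌋ = a₀, and the continued fraction of √D can be computed by hand. Writing the complete
-- quotients as (P + √D)/Q, the pairs (P, Q) run through
--   (a₀, c r^s), (y, r), (a₀, c r^(s-1)), (y, r²), …, (a₀, c),
-- then a short turn from (a₀, c) to (a₀, r^s), and then the mirror image
--   (a₀, r^s), (y, c r), (a₀, r^(s-1)), …, (a₀, 1);
-- every step is exact because Q Q′ = D − P′² telescopes in powers of r. All partial quotients
-- before the last are at most a₀, the last one is 2a₀, so the period is exactly the length of this
-- walk. A one-step turn (when c ∣ d) gives period 4s + 2, a three-step turn (when d ≡ e mod c
-- for a suitable e) gives 4s + 4. Choosing c ≡ m, a₀ ≡ 0 and r ≡ 1 (mod n) makes D ≡ m (mod n).
module Submission where

open import Defs
open import Data.Nat using (ℕ; _≤_)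
open import Data.Nat.Divisibility using (_∣_)
open import Data.Integer using (+_; _-_)
open import Data.Integer.Divisibility using () renaming (_∣_ to _∣ℤ_)
open import Data.Product using (_×_; ∃-syntax)
open import Relation.Nullary using (¬_)

open import Data.Nat
  using (zero; suc; _+_; _*_; _∸_; _^_; _<_; _≤ᵇ_; _≤?_; z≤n; s≤s; >-nonZero)
open import Data.Nat.Properties
open import Data.Nat.DivMod using (_/_; m*n/n≡m; m<n⇒m/n≡0; n/1≡n; /-mono-≤; +-distrib-/-∣ˡ)
open import Data.Nat.Divisibility using (divides; n∣m*n)
open import Data.Nat.Tactic.RingSolver using (solve-∀)
import Data.Integer.Properties as ℤ
import Algebra.Properties.CommutativeSemigroup as CommutativeSemigroup
open import Data.Bool using (true; false; T)
open import Data.Unit using (tt)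
open import Data.Product using (_,_; proj₁; proj₂)
open import Function using (_∘_)
open import Relation.Nullary using (yes; no; contradiction)
open import Relation.Binary.PropositionalEquality

module +-CS = CommutativeSemigroup +-commutativeSemigroup
module *-CS = CommutativeSemigroup *-commutativeSemigroup

isqrt-spec : ∀ n → isqrt n * isqrt n ≤ n × n < suc (isqrt n) * suc (isqrt n)
isqrt-spec zero = z≤n , s≤s z≤n
isqrt-spec (suc n) with isqrt n | isqrt-spec n
... | a | a²≤n , n<[1+a]² with suc a * suc a ≤ᵇ suc n in eq
... | true  = ≤ᵇ⇒≤ (suc a * suc a) (suc n) (subst T (sym eq) tt) ,
              ≤-<-trans n<[1+a]² (*-mono-< (n<1+n (suc a)) (n<1+n (suc a)))
... | false = m≤n⇒m≤1+n a²≤n , ≰⇒> (subst T eq ∘ ≤⇒≤ᵇ)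

isqrt-unique : ∀ {N a} → a * a ≤ N → N < suc a * suc a → isqrt N ≡ a
isqrt-unique {N} {a} a²≤N N<[1+a]² =
  ≤-antisym (root-≤ (proj₁ (isqrt-spec N)) N<[1+a]²) (root-≤ a²≤N (proj₂ (isqrt-spec N)))
  where
  root-≤ : ∀ {b c} → b * b ≤ N → N < suc c * suc c → b ≤ c
  root-≤ b²≤N N<[1+c]² = ≮⇒≥ λ c<b → <⇒≱ N<[1+c]² (≤-trans (*-mono-≤ c<b c<b) b²≤N)

a²+X<[1+a]² : ∀ {a X} → X ≤ a + a → a * a + X < suc a * suc a
a²+X<[1+a]² {a} {X} X≤2a = begin-strict
  a * a + X              ≤⟨ +-monoʳ-≤ (a * a) X≤2a ⟩
  a * a + (a + a)        <⟨ n<1+n _ ⟩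
  suc (a * a + (a + a))  ≡⟨ square-suc a ⟨
  suc a * suc a          ∎
  where
  open ≤-Reasoning
  square-suc : ∀ a → suc a * suc a ≡ suc (a * a + (a + a))
  square-suc = solve-∀

isqrt-a²+X : ∀ {a X} → X ≤ a + a → isqrt (a * a + X) ≡ a
isqrt-a²+X {a} {X} X≤2a = isqrt-unique (m≤m+n (a * a) X) (a²+X<[1+a]² {a} X≤2a)

nonSquare-a²+X : ∀ {a X} → 1 ≤ X → X ≤ a + a → NonSquare (a * a + X)
nonSquare-a²+X {a} {X} 1≤X X≤2a b b²≡a²+X with b ≤? a
... | yes b≤a = <⇒≱ (subst (a * a <_) (sym b²≡a²+X) (m<m+n (a * a) 1≤X)) (*-mono-≤ b≤a b≤a)
... | no  b≰a = <⇒≱ (subst (_< suc a * suc a) (sym b²≡a²+X) (a²+X<[1+a]² {a} X≤2a))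
                    (*-mono-≤ (≰⇒> b≰a) (≰⇒> b≰a))

nonSquare⇒positive : ∀ {D} → NonSquare D → 1 ≤ D
nonSquare⇒positive {zero}  nonSquare = contradiction refl (nonSquare 0)
nonSquare⇒positive {suc _} _         = s≤s z≤n

m*n+o-div-n≡m : ∀ m {n o} → o < n → (m * n + o) div n ≡ m
m*n+o-div-n≡m m {n@(suc _)} {o} o<n = begin
  (m * n + o) / n    ≡⟨ +-distrib-/-∣ˡ o (n∣m*n m) ⟩
  m * n / n + o / n  ≡⟨ cong₂ _+_ (m*n/n≡m m n) (m<n⇒m/n≡0 o<n) ⟩
  m + 0              ≡⟨ +-identityʳ m ⟩
  m                  ∎
  where open ≡-Reasoning

m*n-div-n≡m : ∀ m {n} → 1 ≤ n → (m * n) div n ≡ m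
m*n-div-n≡m m {suc _} _ = m*n/n≡m m _

∣ℤ-of-≡ : ∀ {D m n} E → D ≡ m + n * E → (+ n) ∣ℤ ((+ D) - (+ m))
∣ℤ-of-≡ {m = m} {n} E refl
  rewrite ℤ.[+m]-[+n]≡m⊖n (m + n * E) m | ℤ.⊖-≥ (m≤m+n m (n * E)) | m+n∸m≡n m (n * E)
  = divides E (*-comm n E)

1+a^s≡1-mod-n : ∀ {a n} s → n ∣ a → ∃[ K ] (suc a ^ s ≡ 1 + K * n)
1+a^s≡1-mod-n         zero    _                  = 0 , refl
1+a^s≡1-mod-n {n = n} (suc s) n∣a@(divides x refl) with 1+a^s≡1-mod-n s n∣a
... | K , eq = x + K + x * K * n , trans (cong (suc (x * n) *_) eq) (expand x n K)
  where
  expand : ∀ x n K → (1 + x * n) * (1 + K * n) ≡ 1 + (x + K + x * K * n) * n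
  expand = solve-∀

cfState-suc-cong : ∀ D {i j} → cfState D i ≡ cfState D j → cfState D (suc i) ≡ cfState D (suc j)
cfState-suc-cong D {j = j} eq rewrite eq with cfState D j
... | _ , _ , _ = refl

isPeriod-of-return : ∀ D p → cfState D (suc p) ≡ cfState D 1 → IsPeriod D p
isPeriod-of-return D p return (suc i) _ = cong (proj₂ ∘ proj₂) (returns i)
  where
  returns : ∀ i → cfState D (suc i + p) ≡ cfState D (suc i)
  returns zero    = return
  returns (suc i) = cfState-suc-cong D {suc i + p} {suc i} (returns i)

module ContinuedFractionOf (D a₀ : ℕ) (isqrt-D : isqrt D ≡ a₀) where

  State : ℕ → ℕ → ℕ → Set
  State i P Q = cfState D i ≡ (P , Q , (a₀ + P) div Q)

  record Step (P Q P′ Q′ : ℕ) : Set where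
    constructor step
    field
      quotient : (a₀ + P) div Q * Q ≡ P + P′
      norm     : Q * Q′ + P′ * P′ ≡ D

  Q′-of-norm : ∀ {Q P′ Q′} → 1 ≤ Q → Q * Q′ + P′ * P′ ≡ D → (D ∸ P′ * P′) div Q ≡ Q′
  Q′-of-norm {Q} {P′} {Q′} 1≤Q norm = begin
    (D ∸ P′ * P′) div Q                  ≡⟨ cong (λ x → (x ∸ P′ * P′) div Q) norm ⟨
    (Q * Q′ + P′ * P′ ∸ P′ * P′) div Q   ≡⟨ cong (_div Q) (trans (m+n∸n≡m (Q * Q′) (P′ * P′)) (*-comm Q Q′)) ⟩
    (Q′ * Q) div Q                       ≡⟨ m*n-div-n≡m Q′ 1≤Q ⟩
    Q′                                   ∎
    where open ≡-Reasoning

  next-state : ∀ i {P Q P′ Q′} → 1 ≤ Q → Step P Q P′ Q′ → State i P Q → State (suc i) P′ Q′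
  next-state _ {P} {Q} {P′} {Q′} 1≤Q (step quotient norm) st rewrite st =
    trans (cong (λ p → p , (D ∸ p * p) div Q , (isqrt D + p) div ((D ∸ p * p) div Q)) P₁≡P′)
          (cong₂ (λ a q → P′ , q , (a + P′) div q) isqrt-D (Q′-of-norm {Q} {P′} {Q′} 1≤Q norm))
    where
    P₁≡P′ : (a₀ + P) div Q * Q ∸ P ≡ P′
    P₁≡P′ = trans (cong (_∸ P) quotient) (m+n∸m≡n P P′)

  partial-quotient-≤a₀ : ∀ {P Q} → P ≤ a₀ → 2 ≤ Q → (a₀ + P) div Q ≤ a₀
  partial-quotient-≤a₀ {P} {Q@(suc _)} P≤a₀ 2≤Q = begin
    (a₀ + P) / Q    ≤⟨ /-mono-≤ (+-monoʳ-≤ a₀ P≤a₀) 2≤Q ⟩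
    (a₀ + a₀) / 2   ≡⟨ cong (_/ 2) (trans (cong (_+_ a₀) (sym (+-identityʳ a₀))) (*-comm 2 a₀)) ⟩
    a₀ * 2 / 2      ≡⟨ m*n/n≡m a₀ 2 ⟩
    a₀              ∎
    where open ≤-Reasoning

  -- The bounds make the partial quotient at most a₀ < 2a₀, which is what rules out shorter periods.
  record InnerStep (P Q P′ Q′ : ℕ) : Set where
    constructor inner
    field
      P≤a₀ : P ≤ a₀
      2≤Q  : 2 ≤ Q
      step′ : Step P Q P′ Q′

  infixr 5 _∷_ _++_

  data Path : ℕ → ℕ → ℕ → ℕ → ℕ → Set where
    []  : ∀ {P Q} → Path 0 P Q P Q
    _∷_ : ∀ {n P Q P₁ Q₁ P′ Q′} → InnerStep P Q P₁ Q₁ → Path n P₁ Q₁ P′ Q′ → Path (suc n) P Q P′ Q′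

  _++_ : ∀ {m n P Q P₁ Q₁ P′ Q′} → Path m P Q P₁ Q₁ → Path n P₁ Q₁ P′ Q′ → Path (m + n) P Q P′ Q′
  []      ++ q = q
  (s ∷ p) ++ q = s ∷ (p ++ q)

  follow : ∀ i {n P Q P′ Q′} → Path n P Q P′ Q′ → State i P Q → State (i + n) P′ Q′
  follow i {P = P} {Q = Q} [] st = subst (λ j → State j P Q) (sym (+-identityʳ i)) st
  follow i {suc n} {P′ = P′} {Q′ = Q′} (inner _ 2≤Q s ∷ p) st =
    subst (λ j → State j P′ Q′) (sym (+-suc i n)) (follow (suc i) p (next-state i (<⇒≤ 2≤Q) s st))

  follow-coeff-≤a₀ : ∀ i {n P Q P′ Q′} → Path n P Q P′ Q′ → State i P Q → ∀ l → l < n → cfCoeff D (i + l) ≤ a₀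
  follow-coeff-≤a₀ i (inner P≤a₀ 2≤Q _ ∷ _) st zero _ =
    ≤-trans (≤-reflexive (trans (cong (cfCoeff D) (+-identityʳ i)) (cong (proj₂ ∘ proj₂) st)))
            (partial-quotient-≤a₀ P≤a₀ 2≤Q)
  follow-coeff-≤a₀ i (inner _ 2≤Q s ∷ p) st (suc l) (s≤s l<n) =
    subst (_≤ a₀) (cong (cfCoeff D) (sym (+-suc i l))) (follow-coeff-≤a₀ (suc i) p (next-state i (<⇒≤ 2≤Q) s st) l l<n)

  periodLength-of-path : ∀ {n Q₁} → 1 ≤ a₀ → Q₁ + a₀ * a₀ ≡ D → Path n a₀ Q₁ a₀ 1 → PeriodLength D (suc n)
  periodLength-of-path {n} {Q₁} 1≤a₀ Q₁+a₀²≡D path =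
    s≤s z≤n , isPeriod-of-return D (suc n) (trans return (sym first)) , no-shorter-period
    where
    initial : State 0 0 1
    initial = cong (λ a → 0 , 1 , a) (trans isqrt-D (sym (trans (n/1≡n (a₀ + 0)) (+-identityʳ a₀))))

    step-to-Q₁ : ∀ P → Step P 1 a₀ Q₁
    step-to-Q₁ P = step (trans (*-identityʳ _) (trans (n/1≡n (a₀ + P)) (+-comm a₀ P)))
                        (trans (cong (_+ a₀ * a₀) (*-identityˡ Q₁)) Q₁+a₀²≡D)

    first : State 1 a₀ Q₁
    first = next-state 0 ≤-refl (step-to-Q₁ 0) initial

    last : State (suc n) a₀ 1
    last = follow 1 path first

    return : State (suc (suc n)) a₀ Q₁
    return = next-state (suc n) ≤-refl (step-to-Q₁ a₀) last

    no-shorter-period : ∀ j → 1 ≤ j → j < suc n → ¬ IsPeriod D j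
    no-shorter-period j 1≤j (s≤s j≤n) period = <⇒≱ (m<m+n a₀ 1≤a₀) (begin
      a₀ + a₀                 ≡⟨ trans (cong (proj₂ ∘ proj₂) last) (n/1≡n (a₀ + a₀)) ⟨
      cfCoeff D (suc n)       ≡⟨ cong (cfCoeff D ∘ suc) (m∸n+n≡m j≤n) ⟨
      cfCoeff D (suc l + j)   ≡⟨ period (suc l) (s≤s z≤n) ⟩
      cfCoeff D (suc l)       ≤⟨ follow-coeff-≤a₀ 1 path first l (∸-monoʳ-< 1≤j j≤n) ⟩
      a₀                      ∎)
      where
      open ≤-Reasoning
      l = n ∸ j

module ExplicitExpansion (c d t s y : ℕ) (2≤c : 2 ≤ c) (1≤d : 1 ≤ d) (1≤t : 1 ≤ t)
                    (balance : y + (y + d) ≡ c * suc (d * t) ^ s * t) where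

  r R a₀ D : ℕ
  r  = suc (d * t)
  R  = r ^ s
  a₀ = y + d
  D  = a₀ * a₀ + c * R

  1≤c : 1 ≤ c
  1≤c = <⇒≤ 2≤c

  1≤a₀ : 1 ≤ a₀
  1≤a₀ = ≤-trans 1≤d (m≤n+m d y)

  2≤r : 2 ≤ r
  2≤r = s≤s (*-mono-≤ 1≤d 1≤t)

  1≤R : 1 ≤ R
  1≤R = m^n>0 r s

  r≤γ*r^suc : ∀ {γ} u → 1 ≤ γ → r ≤ γ * r ^ suc u
  r≤γ*r^suc {γ} u 1≤γ = begin
    r               ≤⟨ m≤m*n r (r ^ u) {{m^n≢0 r u}} ⟩
    r * r ^ u       ≤⟨ m≤n*m (r * r ^ u) γ {{>-nonZero 1≤γ}} ⟩
    γ * r ^ suc u   ∎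
    where open ≤-Reasoning

  cR≤2a₀ : c * R ≤ a₀ + a₀
  cR≤2a₀ = begin
    c * R      ≤⟨ m≤m*n (c * R) t {{>-nonZero 1≤t}} ⟩
    c * R * t  ≡⟨ balance ⟨
    y + a₀     ≤⟨ +-monoˡ-≤ a₀ (m≤m+n y d) ⟩
    a₀ + a₀    ∎
    where open ≤-Reasoning

  isqrt-D : isqrt D ≡ a₀
  isqrt-D = isqrt-a²+X {a₀} cR≤2a₀

  nonSquare-D : NonSquare D
  nonSquare-D = nonSquare-a²+X {a₀} (*-mono-≤ 1≤c 1≤R) cR≤2a₀

  open ContinuedFractionOf D a₀ isqrt-D

  a₀+a₀≡cRt+d : a₀ + a₀ ≡ c * R * t + d
  a₀+a₀≡cRt+d = trans (+-CS.xy∙z≈xz∙y y d a₀) (cong (_+ d) balance)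

  distribute : ∀ δ → (R * t + δ) * c ≡ c * R * t + δ * c
  distribute δ = lemma R t δ c
    where
    lemma : ∀ R t δ c → (R * t + δ) * c ≡ c * R * t + δ * c
    lemma = solve-∀

  norm-at-a₀ : ∀ Q Q′ → Q * Q′ ≡ c * R → Q * Q′ + a₀ * a₀ ≡ D
  norm-at-a₀ _ _ QQ′≡cR = trans (cong (_+ a₀ * a₀) QQ′≡cR) (+-comm (c * R) (a₀ * a₀))

  norm-at-y : ∀ Q Q′ → Q * Q′ ≡ c * r ^ suc s → Q * Q′ + y * y ≡ D
  norm-at-y Q Q′ QQ′≡crR = begin
    Q * Q′ + y * y                   ≡⟨ cong (_+ y * y) QQ′≡crR ⟩
    c * (r * R) + y * y              ≡⟨ expand c d t R y ⟩
    y * y + d * (c * R * t) + c * R  ≡⟨ cong (λ x → y * y + d * x + c * R) balance ⟨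
    y * y + d * (y + a₀) + c * R     ≡⟨ complete-square y d (c * R) ⟩
    D                                ∎
    where
    open ≡-Reasoning
    expand : ∀ c d t R y → c * (suc (d * t) * R) + y * y ≡ y * y + d * (c * R * t) + c * R
    expand = solve-∀
    complete-square : ∀ y d X → y * y + d * (y + (y + d)) + X ≡ (y + d) * (y + d) + X
    complete-square = solve-∀

  module Descent (α β : ℕ) (αβ≡c : α * β ≡ c) (1≤α : 1 ≤ α) (1≤β : 1 ≤ β) where

    product-of-powers : ∀ a b {e} → a + b ≡ e → α * r ^ a * (β * r ^ b) ≡ c * r ^ e
    product-of-powers a b {e} a+b≡e = begin
      α * r ^ a * (β * r ^ b)  ≡⟨ *-CS.interchange α (r ^ a) β (r ^ b) ⟩
      α * β * (r ^ a * r ^ b)  ≡⟨ cong₂ _*_ αβ≡c (trans (sym (^-distribˡ-+-* r a b)) (cong (r ^_) a+b≡e)) ⟩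
      c * r ^ e                ∎
      where open ≡-Reasoning

    descend-to-y : ∀ u j → suc u + j ≡ s → InnerStep a₀ (α * r ^ suc u) y (β * r ^ suc j)
    descend-to-y u j e = inner ≤-refl (≤-trans 2≤r r≤Q) (step quotient norm)
      where
      open ≡-Reasoning
      Q Q′ q : ℕ
      Q  = α * r ^ suc u
      Q′ = β * r ^ suc j
      q  = β * r ^ j * t
      norm : Q * Q′ + y * y ≡ D
      norm = norm-at-y Q Q′ (product-of-powers (suc u) (suc j) (cong suc (trans (+-suc u j) e)))
      r≤Q : r ≤ Q
      r≤Q = r≤γ*r^suc u 1≤α
      qQ≡cRt : q * Q ≡ c * R * t
      qQ≡cRt = trans (*-CS.xy∙z≈zx∙y (β * r ^ j) t Q) (cong (_* t) (product-of-powers (suc u) j e))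
      quotient : (a₀ + a₀) div Q * Q ≡ a₀ + y
      quotient = begin
        (a₀ + a₀) div Q * Q    ≡⟨ cong (λ x → x div Q * Q) (trans a₀+a₀≡cRt+d (sym (cong (_+ d) qQ≡cRt))) ⟩
        (q * Q + d) div Q * Q  ≡⟨ cong (_* Q) (m*n+o-div-n≡m q (<-≤-trans d<r r≤Q)) ⟩
        q * Q                  ≡⟨ trans qQ≡cRt (sym balance) ⟩
        y + a₀                 ≡⟨ +-comm y a₀ ⟩
        a₀ + y                 ∎
        where
        d<r : d < r
        d<r = s≤s (m≤m*n d t {{>-nonZero 1≤t}})

    ascend-to-a₀ : ∀ u j → suc u + j ≡ s → InnerStep y (β * r ^ suc j) a₀ (α * r ^ u)
    ascend-to-a₀ u j e = inner (m≤m+n y d) 2≤Q (step quotient norm)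
      where
      open ≡-Reasoning
      Q Q′ q : ℕ
      Q  = β * r ^ suc j
      Q′ = α * r ^ u
      q  = α * r ^ u * t
      u+1+j≡s : u + suc j ≡ s
      u+1+j≡s = trans (+-suc u j) e
      2≤Q : 2 ≤ Q
      2≤Q = ≤-trans 2≤r (r≤γ*r^suc j 1≤β)
      norm : Q * Q′ + a₀ * a₀ ≡ D
      norm = norm-at-a₀ Q Q′ (trans (*-comm Q Q′) (product-of-powers u (suc j) u+1+j≡s))
      qQ≡cRt : q * Q ≡ c * R * t
      qQ≡cRt = trans (*-CS.xy∙z≈xz∙y (α * r ^ u) t Q) (cong (_* t) (product-of-powers u (suc j) u+1+j≡s))
      quotient : (a₀ + y) div Q * Q ≡ y + a₀
      quotient = begin
        (a₀ + y) div Q * Q  ≡⟨ cong (λ x → x div Q * Q) (trans (+-comm a₀ y) (trans balance (sym qQ≡cRt))) ⟩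
        (q * Q) div Q * Q   ≡⟨ cong (_* Q) (m*n-div-n≡m q (<⇒≤ 2≤Q)) ⟩
        q * Q               ≡⟨ trans qQ≡cRt (sym balance) ⟩
        y + a₀              ∎

    descent : ∀ u j → u + j ≡ s → Path (u * 2) a₀ (α * r ^ u) a₀ α
    descent zero    j _ = subst (λ Q → Path 0 a₀ Q a₀ α) (sym (*-identityʳ α)) []
    descent (suc u) j e = descend-to-y u j e ∷ ascend-to-a₀ u j e ∷ descent u (suc j) (trans (+-suc u j) e)

  first-half : Path (s * 2) a₀ (c * R) a₀ c
  first-half = Descent.descent c 1 (*-identityʳ c) 1≤c ≤-refl s 0 (+-identityʳ s)

  second-half : Path (s * 2) a₀ (1 * R) a₀ 1
  second-half = Descent.descent 1 c (*-identityˡ c) ≤-refl 1≤c s 0 (+-identityʳ s)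

  turn-to-R : ∀ {P} X → P ≤ a₀ → X * c ≡ P + a₀ → InnerStep P c a₀ (1 * R)
  turn-to-R {P} X P≤a₀ Xc≡P+a₀ =
    inner P≤a₀ 2≤c (step quotient (norm-at-a₀ c (1 * R) (cong (c *_) (*-identityˡ R))))
    where
    open ≡-Reasoning
    quotient : (a₀ + P) div c * c ≡ P + a₀
    quotient = begin
      (a₀ + P) div c * c  ≡⟨ cong (λ x → x div c * c) (trans (+-comm a₀ P) (sym Xc≡P+a₀)) ⟩
      (X * c) div c * c   ≡⟨ cong (_* c) (m*n-div-n≡m X 1≤c) ⟩
      X * c               ≡⟨ Xc≡P+a₀ ⟩
      P + a₀              ∎

  -- (a₀, c) → (z, Q₂) → (z, c) → (a₀, r^s) with z = a₀ − e; the middle step is its own mirror image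
  -- because 2z = 2e·Q₂.
  module ThreeStepTurn (δ e : ℕ) (d≡δc+e : d ≡ δ * c + e) (1≤e : 1 ≤ e) (e<c : e < c)
                       (z≡eQ₂ : y + δ * c ≡ e * (e * (R * t + δ) + R)) where

    X z Q₂ : ℕ
    X  = R * t + δ
    z  = y + δ * c
    Q₂ = e * X + R

    a₀≡z+e : a₀ ≡ z + e
    a₀≡z+e = trans (cong (_+_ y) d≡δc+e) (sym (+-assoc y (δ * c) e))

    z≤a₀ : z ≤ a₀
    z≤a₀ = subst (z ≤_) (sym a₀≡z+e) (m≤m+n z e)

    Xc≡a₀+z : X * c ≡ a₀ + z
    Xc≡a₀+z = begin
      (R * t + δ) * c    ≡⟨ distribute δ ⟩
      c * R * t + δ * c  ≡⟨ cong (_+ δ * c) balance ⟨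
      y + a₀ + δ * c     ≡⟨ +-CS.xy∙z≈y∙xz y a₀ (δ * c) ⟩
      a₀ + (y + δ * c)   ∎
      where open ≡-Reasoning

    e<Q₂ : e < Q₂
    e<Q₂ = ≤-<-trans (m≤m*n e X {{>-nonZero 1≤X}}) (m<m+n (e * X) 1≤R)
      where
      1≤X : 1 ≤ X
      1≤X = ≤-trans (*-mono-≤ 1≤R 1≤t) (m≤m+n (R * t) δ)

    norm-at-z : c * Q₂ + z * z ≡ D
    norm-at-z = begin
      c * (e * X + R) + z * z          ≡⟨ expand c e X R z ⟩
      z * z + e * (X * c) + c * R      ≡⟨ cong (λ x → z * z + e * x + c * R) (trans Xc≡a₀+z (cong (_+ z) a₀≡z+e)) ⟩
      z * z + e * (z + e + z) + c * R  ≡⟨ complete-square z e (c * R) ⟩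
      (z + e) * (z + e) + c * R        ≡⟨ cong (λ a → a * a + c * R) a₀≡z+e ⟨
      D                                ∎
      where
      open ≡-Reasoning
      expand : ∀ c e X R z → c * (e * X + R) + z * z ≡ z * z + e * (X * c) + c * R
      expand = solve-∀
      complete-square : ∀ z e x → z * z + e * (z + e + z) + x ≡ (z + e) * (z + e) + x
      complete-square = solve-∀

    descend-to-z : InnerStep a₀ c z Q₂
    descend-to-z = inner ≤-refl 2≤c (step quotient norm-at-z)
      where
      open ≡-Reasoning
      quotient : (a₀ + a₀) div c * c ≡ a₀ + z
      quotient = begin
        (a₀ + a₀) div c * c    ≡⟨ cong (λ x → x div c * c) 2a₀≡Xc+e ⟩
        (X * c + e) div c * c  ≡⟨ cong (_* c) (m*n+o-div-n≡m X e<c) ⟩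
        X * c                  ≡⟨ Xc≡a₀+z ⟩
        a₀ + z                 ∎
        where
        2a₀≡Xc+e : a₀ + a₀ ≡ X * c + e
        2a₀≡Xc+e = trans (cong (_+_ a₀) a₀≡z+e) (trans (sym (+-assoc a₀ z e)) (cong (_+ e) (sym Xc≡a₀+z)))

    reflect-at-z : InnerStep z Q₂ z c
    reflect-at-z = inner z≤a₀ (≤-trans (s≤s 1≤e) e<Q₂) (step quotient (trans (cong (_+ z * z) (*-comm Q₂ c)) norm-at-z))
      where
      open ≡-Reasoning
      2eQ₂≡z+z : (e + e) * Q₂ ≡ z + z
      2eQ₂≡z+z = trans (*-distribʳ-+ Q₂ e e) (cong (λ x → x + x) (sym z≡eQ₂))
      quotient : (a₀ + z) div Q₂ * Q₂ ≡ z + z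
      quotient = begin
        (a₀ + z) div Q₂ * Q₂               ≡⟨ cong (λ x → x div Q₂ * Q₂) a₀+z≡2eQ₂+e ⟩
        ((e + e) * Q₂ + e) div Q₂ * Q₂     ≡⟨ cong (_* Q₂) (m*n+o-div-n≡m (e + e) e<Q₂) ⟩
        (e + e) * Q₂                       ≡⟨ 2eQ₂≡z+z ⟩
        z + z                              ∎
        where
        a₀+z≡2eQ₂+e : a₀ + z ≡ (e + e) * Q₂ + e
        a₀+z≡2eQ₂+e = begin
          a₀ + z            ≡⟨ cong (_+ z) a₀≡z+e ⟩
          z + e + z         ≡⟨ +-CS.xy∙z≈xz∙y z e z ⟩
          z + z + e         ≡⟨ cong (_+ e) 2eQ₂≡z+z ⟨
          (e + e) * Q₂ + e  ∎

    turn : Path 3 a₀ c a₀ (1 * R)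
    turn = descend-to-z ∷ reflect-at-z ∷ turn-to-R X z≤a₀ (trans Xc≡a₀+z (+-comm a₀ z)) ∷ []

  periodLength-of-turn : ∀ {n} → Path n a₀ c a₀ (1 * R) → PeriodLength D (suc (s * 2 + (n + s * 2)))
  periodLength-of-turn turn =
    periodLength-of-path 1≤a₀ (+-comm (c * R) (a₀ * a₀)) (first-half ++ turn ++ second-half)

  periodLength-4s+2 : ∀ δ → d ≡ δ * c → PeriodLength D (suc (s * 2) * 2)
  periodLength-4s+2 δ d≡δc =
    subst (PeriodLength D) (length s) (periodLength-of-turn (turn-to-R (R * t + δ) ≤-refl Xc≡2a₀ ∷ []))
    where
    open ≡-Reasoning
    length : ∀ s → suc (s * 2 + (1 + s * 2)) ≡ suc (s * 2) * 2
    length = solve-∀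
    Xc≡2a₀ : (R * t + δ) * c ≡ a₀ + a₀
    Xc≡2a₀ = begin
      (R * t + δ) * c    ≡⟨ distribute δ ⟩
      c * R * t + δ * c  ≡⟨ cong (_+_ (c * R * t)) d≡δc ⟨
      c * R * t + d      ≡⟨ a₀+a₀≡cRt+d ⟨
      a₀ + a₀            ∎

  periodLength-4s+4 : ∀ δ e → d ≡ δ * c + e → 1 ≤ e → e < c → y + δ * c ≡ e * (e * (R * t + δ) + R) →
                      PeriodLength D (suc (suc (s * 2)) * 2)
  periodLength-4s+4 δ e d≡δc+e 1≤e e<c z≡eQ₂ =
    subst (PeriodLength D) (length s) (periodLength-of-turn (ThreeStepTurn.turn δ e d≡δc+e 1≤e e<c z≡eQ₂))
    where
    length : ∀ s → suc (s * 2 + (3 + s * 2)) ≡ suc (suc (s * 2)) * 2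
    length = solve-∀

  D≡m-mod-n : ∀ {m n} γ A K → c ≡ m + n * γ → a₀ ≡ n * A → R ≡ 1 + K * n → (+ n) ∣ℤ ((+ D) - (+ m))
  D≡m-mod-n {m} {n} γ A K c≡m+nγ a₀≡nA R≡1+Kn = ∣ℤ-of-≡ (γ + (n * A * A + c * K)) (begin
    a₀ * a₀ + c * R                         ≡⟨ cong₂ (λ a R → a * a + c * R) a₀≡nA R≡1+Kn ⟩
    n * A * (n * A) + c * (1 + K * n)       ≡⟨ expand n A c K ⟩
    c + n * (n * A * A + c * K)             ≡⟨ cong (_+ n * (n * A * A + c * K)) c≡m+nγ ⟩
    m + n * γ + n * (n * A * A + c * K)     ≡⟨ collect m n γ (n * A * A + c * K) ⟩
    m + n * (γ + (n * A * A + c * K))       ∎)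
    where
    open ≡-Reasoning
    expand : ∀ n A c K → n * A * (n * A) + c * (1 + K * n) ≡ c + n * (n * A * A + c * K)
    expand = solve-∀
    collect : ∀ m n γ x → m + n * γ + n * x ≡ m + n * (γ + x)
    collect = solve-∀

D-with-period-4s+2 : ∀ m n s → 1 ≤ m → 1 ≤ n →
  ∃[ D ] (1 ≤ D × NonSquare D × PeriodLength D (suc (s * 2) * 2) × (+ n) ∣ℤ ((+ D) - (+ m)))
D-with-period-4s+2 m n s 1≤m 1≤n =
  D , nonSquare⇒positive nonSquare-D , nonSquare-D , periodLength-4s+2 t (*-comm c t) ,
  D≡m-mod-n 1 (c * (K * n + 2)) K (cong (_+_ m) (sym (*-identityʳ n))) (a₀-identity c n K) R≡1+Kn
  where
  c t d y K : ℕ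
  c = m + n
  t = 2 * n
  d = c * t

  n∣dt : n ∣ d * t
  n∣dt = divides (d * 2) (sym (*-assoc d 2 n))

  K = proj₁ (1+a^s≡1-mod-n s n∣dt)
  y = c * n * (K * n)

  R≡1+Kn : suc (d * t) ^ s ≡ 1 + K * n
  R≡1+Kn = proj₂ (1+a^s≡1-mod-n s n∣dt)

  balance-identity : ∀ c n K → let y = c * n * (K * n) ; d = c * (2 * n) in
                     y + (y + d) ≡ c * (1 + K * n) * (2 * n)
  balance-identity = solve-∀

  a₀-identity : ∀ c n K → let y = c * n * (K * n) ; d = c * (2 * n) in
                y + d ≡ n * (c * (K * n + 2))
  a₀-identity = solve-∀

  1≤t : 1 ≤ t
  1≤t = ≤-trans 1≤n (m≤n*m n 2)

  1≤d : 1 ≤ d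
  1≤d = *-mono-≤ (≤-trans 1≤m (m≤m+n m n)) 1≤t

  balance : y + (y + d) ≡ c * suc (d * t) ^ s * t
  balance = trans (balance-identity c n K) (cong (λ R → c * R * t) (sym R≡1+Kn))

  open ExplicitExpansion c d t s y (+-mono-≤ 1≤m 1≤n) 1≤d 1≤t balance

-- With w = 1 + 2n·e both the balance condition and z = e·Q₂ hold, while c = m w ≡ m (mod n).
D-with-period-4s+4 : ∀ m n s → 1 ≤ m → 1 ≤ n →
  ∃[ D ] (1 ≤ D × NonSquare D × PeriodLength D (suc (suc (s * 2)) * 2) × (+ n) ∣ℤ ((+ D) - (+ m)))
D-with-period-4s+4 m n s 1≤m 1≤n =
  D , nonSquare⇒positive nonSquare-D , nonSquare-D , periodLength-4s+4 n e refl 1≤e e<c z≡eQ₂ ,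
  D≡m-mod-n (2 * m * e) (m * (w * K * n + e * n) + c + m) K (c-identity m n) (a₀-identity m n K) R≡1+Kn
  where
  e w c t d y K : ℕ
  e = m * n
  w = 1 + 2 * n * e
  c = m * w
  t = 2 * n
  d = n * c + e

  n∣dt : n ∣ d * t
  n∣dt = divides (d * 2) (sym (*-assoc d 2 n))

  K = proj₁ (1+a^s≡1-mod-n s n∣dt)
  y = e * (w * K * n + e * n)

  R≡1+Kn : suc (d * t) ^ s ≡ 1 + K * n
  R≡1+Kn = proj₂ (1+a^s≡1-mod-n s n∣dt)

  balance-identity : ∀ m n K → let e = m * n ; w = 1 + 2 * n * e ; c = m * w ; y = e * (w * K * n + e * n) in
                     y + (y + (n * c + e)) ≡ c * (1 + K * n) * (2 * n)
  balance-identity = solve-∀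

  z-identity : ∀ m n K → let e = m * n ; w = 1 + 2 * n * e ; c = m * w ; y = e * (w * K * n + e * n) in
               y + n * c ≡ e * (e * ((1 + K * n) * (2 * n) + n) + (1 + K * n))
  z-identity = solve-∀

  c-identity : ∀ m n → m * (1 + 2 * n * (m * n)) ≡ m + n * (2 * m * (m * n))
  c-identity = solve-∀

  a₀-identity : ∀ m n K → let e = m * n ; w = 1 + 2 * n * e ; c = m * w ; y = e * (w * K * n + e * n) in
                y + (n * c + e) ≡ n * (m * (w * K * n + e * n) + c + m)
  a₀-identity = solve-∀

  1≤e : 1 ≤ e
  1≤e = *-mono-≤ 1≤m 1≤n

  n<w : n < w
  n<w = s≤s (≤-trans (m≤n*m n 2) (m≤m*n (2 * n) e {{>-nonZero 1≤e}}))

  e<c : e < c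
  e<c = *-monoʳ-< m {{>-nonZero 1≤m}} n<w

  2≤c : 2 ≤ c
  2≤c = ≤-trans (≤-trans (s≤s 1≤n) n<w) (m≤n*m w m {{>-nonZero 1≤m}})

  balance : y + (y + d) ≡ c * suc (d * t) ^ s * t
  balance = trans (balance-identity m n K) (cong (λ R → c * R * t) (sym R≡1+Kn))

  z≡eQ₂ : y + n * c ≡ e * (e * (suc (d * t) ^ s * t + n) + suc (d * t) ^ s)
  z≡eQ₂ = trans (z-identity m n K) (cong (λ R → e * (e * (R * t + n) + R)) (sym R≡1+Kn))

  open ExplicitExpansion c d t s y 2≤c (≤-trans 1≤e (m≤n+m e (n * c))) (≤-trans 1≤n (m≤n*m n 2)) balance

data ParityView : ℕ → Set where
  odd  : ∀ s → ParityView (suc (s * 2))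
  even : ∀ s → ParityView (s * 2)

parity-view : ∀ q → ParityView q
parity-view zero = even zero
parity-view (suc q) with parity-view q
... | odd s  = even (suc s)
... | even s = odd s

theorem3p5 : (m n k : ℕ) → 1 ≤ m → 1 ≤ n → ¬ (2 ∣ n) → 1 ≤ k → 2 ∣ k →
    ∃[ D ] (1 ≤ D × NonSquare D × PeriodLength D k × (+ n) ∣ℤ ((+ D) - (+ m)))
theorem3p5 m n .(q * 2) 1≤m 1≤n _ 1≤k (divides q refl) with parity-view q
... | odd s        = D-with-period-4s+2 m n s 1≤m 1≤n
... | even (suc s) = D-with-period-4s+4 m n s 1≤m 1≤n
... | even zero    = contradiction 1≤k λ ()
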